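{- Let $\mathsf{PROP}$ be a fixed finite set of propositional symbols and $L\in\mathbb{N}$. For any class $\mathcal{T}$ of finite pointed tree-shaped Kripke models over $\mathsf{PROP}$ of height at most $L$, both the injective homomorphism relation and the homomorphism relation on $\mathcal{T}$ are well-quasi-orders.
   Context: A Kripke model is $\mathfrak{M}=(W,R,V)$ with $W$ non-empty finite, $R\subseteq W\times W$, $V:\mathsf{PROP}\to 2^W$; a pointed model is $(\mathfrak{M},w)$. It is tree-shaped if every $v\in W$ has a unique directed $R$-path from $w$; its height is the length of the longest directed path from $w$. $(\mathfrak{M},w)\preceq(\mathfrak{N},v)$ under the homomorphism relation iff there is $f:W\to W'$ (where $\mathfrak{N}=(W',R',V')$) with $f(w)=v$ such that $uRz$ implies $f(u)R'f(z)$ and $u\in V(p)$ implies $f(u)\in V'(p)$; under the injective homomorphism relation additionally $f$ is injective. A well-quasi-order is a reflexive, transitive relation such that every infinite sequence $a_1,a_2,\dots$ contains $i<j$ with $a_i\preceq a_j$. -}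

module Defs where

open import Level using (Level; _⊔_) renaming (suc to lsuc)
open import Data.Nat using (ℕ; zero; suc; _≤_; _<_)
open import Data.Fin using (Fin)
open import Data.Bool using (Bool; T)
open import Data.Product using (Σ; Σ-syntax; ∃; _×_; _,_)
open import Relation.Binary.PropositionalEquality using (_≡_)
open import Function.Definitions using (Injective)

-- PROP is the finite set  Fin k  of propositional symbols.
-- A finite Kripke model with n worlds (W = Fin n, non-empty since it is pointed):
record Model (k n : ℕ) : Set where
  field
    R : Fin n → Fin n → Bool
    V : Fin k → Fin n → Bool
open Model public

record PModel (k : ℕ) : Set where
  constructor pointed
  field
    size  : ℕ
    model : Model k size
    root  : Fin size
open PModel public

data Path {k n : ℕ} (M : Model k n) : Fin n → Fin n → Set where
  here  : ∀ {u} → Path M u u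
  step  : ∀ {u x v} → T (R M u x) → Path M x v → Path M u v

pathLength : ∀ {k n} {M : Model k n} {u v} → Path M u v → ℕ
pathLength here       = zero
pathLength (step _ p) = suc (pathLength p)

TreeShaped : ∀ {k} → PModel k → Set
TreeShaped (pointed n M w) =
  (v : Fin n) → Path M w v × ((p q : Path M w v) → p ≡ q)

HeightAtMost : ∀ {k} → ℕ → PModel k → Set
HeightAtMost L (pointed n M w) = ∀ {v} (p : Path M w v) → pathLength p ≤ L

record Hom {k} (A B : PModel k) : Set where
  field
    fun      : Fin (size A) → Fin (size B)
    pres-pt  : fun (root A) ≡ root B
    pres-R   : ∀ u z → T (R (model A) u z) → T (R (model B) (fun u) (fun z))
    pres-V   : ∀ p u → T (V (model A) p u) → T (V (model B) p (fun u))
open Hom public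

_≼hom_ : ∀ {k} → PModel k → PModel k → Set
A ≼hom B = Hom A B

_≼inj_ : ∀ {k} → PModel k → PModel k → Set
A ≼inj B = Σ[ h ∈ Hom A B ] Injective _≡_ _≡_ (fun h)

IsWQOOn : ∀ {a ℓ r} {A : Set a} → (A → Set ℓ) → (A → A → Set r) → Set (a ⊔ ℓ ⊔ r)
IsWQOOn {A = A} P _≼_ =
  ((x : A) → P x → x ≼ x)
  × ((x y z : A) → P x → P y → P z → x ≼ y → y ≼ z → x ≼ z)
  × ((s : ℕ → A) → ((i : ℕ) → P (s i)) → Σ[ i ∈ ℕ ] Σ[ j ∈ ℕ ] (i < j × s i ≼ s j))

-- An almost-full relation R (Vytiniotis, Coquand and Wahlstedt) is given by an inductive
-- witness that every sequence s has a good pair i < j with R (s i) (s j).  Almost-fullness is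
-- preserved by intersection (the constructive Ramsey theorem), hence by products, and by
-- embedding of lists (Higman's lemma).  So embedding is almost full on node-labelled ordered
-- trees of height h, by induction on h.  A pointed model of height at most L unfolds from its root
-- into such a tree in which the children of a world occupy the slots of all worlds, empty
-- unless the world is a successor.  Because the slots are indexed by worlds, an embedding of the
-- unfoldings of two tree-shaped models is an injective homomorphism.
module Submission where

open import Defs
open import Level using (Level; 0ℓ)
open import Data.Nat using (ℕ; zero; suc; _≤_; _<_; z≤n; s≤s)
open import Data.Product using (Σ-syntax; ∃; -,_; _×_; _,_; proj₁; proj₂; map₂)
open import Data.Product.Relation.Binary.Pointwise.NonDependent using (×-decidable) renaming (Pointwise to ×-Pointwise)
open import Data.Sum using (_⊎_; inj₁; inj₂; [_,_]; map₁)
import Data.Sum as Sum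
open import Data.Bool using (Bool; true; false; T; if_then_else_)
open import Data.Bool.Properties using (T-irrelevant)
open import Data.Unit using (tt)
open import Data.Fin using (Fin; zero; suc)
import Data.Fin as Fin
open import Data.Fin.Properties using (lift-injective; suc-injective)
open import Data.Maybe using (Maybe; just; nothing)
open import Data.List using (List; []; _∷_; tabulate)
open import Data.List.Relation.Unary.All using (All; []; _∷_)
open import Data.List.Relation.Unary.First using (FirstView; _++_∷_; first)
open import Data.List.Relation.Unary.First.Properties using (toView)
open import Data.List.Relation.Binary.Sublist.Heterogeneous using (Sublist; []; _∷ʳ_; _∷_; minimum)
open import Data.List.Relation.Binary.Sublist.Heterogeneous.Properties using (++⁺; ++ˡ; ++ʳ; sublist?)
open import Data.Vec.Functional using (head; tail)
open import Data.Vec.Functional.Relation.Binary.Pointwise using (Pointwise)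
open import Data.Vec.Functional.Relation.Binary.Pointwise.Properties using (decidable)
open import Function using (_∘_; _on_; id)
open import Function.Definitions using (Injective)
open import Relation.Binary.Core using (Rel; REL; _⇒_)
open import Relation.Binary.Definitions using (Universal; Decidable)
open import Relation.Binary.Construct.Intersection using (_∩_)
open import Relation.Binary.PropositionalEquality using (_≡_; _≢_; refl; sym; trans; cong; subst)
open import Relation.Nullary using (yes; no; contradiction)
open import Relation.Nullary.Decidable using (T?; _⊎-dec_; _→-dec_; toSum)
open import Relation.Unary using (Pred; ∁)

private
  variable
    k m n : ℕ
    A B X Y : Set
    a : A
    xs ys : List A
    Q S Q₁ Q₂ : Rel A 0ℓ

infixl 5 _↑_

-- Once a sequence has started with a, any later x with Q a x already closes a good pair.
_↑_ : Rel A 0ℓ → A → Rel A 0ℓ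
(Q ↑ a) x y = Q x y ⊎ Q a x

data AlmostFull {A : Set} (Q : Rel A 0ℓ) : Set where
  full : Universal Q → AlmostFull Q
  lift : (∀ a → AlmostFull (Q ↑ a)) → AlmostFull Q

af-mono : Q ⇒ S → AlmostFull Q → AlmostFull S
af-mono Q⇒S (full r) = full λ x y → Q⇒S (r x y)
af-mono Q⇒S (lift g) = lift λ a → af-mono (Sum.map Q⇒S Q⇒S) (g a)

af-on : (f : B → A) → AlmostFull Q → AlmostFull (Q on f)
af-on f (full r) = full λ x y → r (f x) (f y)
af-on f (lift g) = lift λ b → af-on f (g (f b))

af-good : AlmostFull Q → (s : ℕ → A) → Σ[ i ∈ ℕ ] Σ[ j ∈ ℕ ] (i < j × Q (s i) (s j))
af-good (full r) s = 0 , 1 , s≤s z≤n , r (s 0) (s 1)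
af-good (lift g) s with af-good (g (s 0)) (s ∘ suc)
... | i , j , i<j , inj₁ r = suc i , suc j , s≤s i<j , r
... | i , j , i<j , inj₂ r = 0 , suc i , s≤s z≤n , r

factor : {U V W : Set} → U ⊎ V → U ⊎ W → U ⊎ (V × W)
factor (inj₁ p) _        = inj₁ p
factor (inj₂ _) (inj₁ p) = inj₁ p
factor (inj₂ q) (inj₂ u) = inj₂ (q , u)

-- Stated for arbitrary Q₁ ⇒ S ∪ …, Q₂ ⇒ S ∪ … so that the induction can run on the proofs
-- for Q₁ and Q₂ while S grows.
af-∪-const : {p₁ p₂ : Set} → AlmostFull Q₁ → AlmostFull Q₂
           → Q₁ ⇒ (λ x y → S x y ⊎ p₁) → Q₂ ⇒ (λ x y → S x y ⊎ p₂)
           → AlmostFull (λ x y → S x y ⊎ p₁ × p₂)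
af-∪-const (full r₁) af₂ h₁ h₂ = af-mono (λ r₂ → factor (h₁ (r₁ _ _)) (h₂ r₂)) af₂
af-∪-const (lift g₁) af₂ h₁ h₂ = lift λ a →
  af-mono [ Sum.map inj₁ inj₁ , inj₁ ∘ inj₂ ]
    (af-∪-const (g₁ a) af₂ [ (λ r → map₁ inj₁ (h₁ r)) , (λ r → map₁ inj₂ (h₁ r)) ]
                           (λ r → map₁ inj₁ (h₂ r)))

af-∪-pred : {P₁ P₂ : Pred A 0ℓ} → AlmostFull Q₁ → AlmostFull Q₂
          → Q₁ ⇒ (λ x y → S x y ⊎ P₁ x) → Q₂ ⇒ (λ x y → S x y ⊎ P₂ x)
          → AlmostFull (λ x y → S x y ⊎ P₁ x × P₂ x)
af-∪-pred (full r₁) af₂ h₁ h₂ = af-mono (λ r₂ → factor (h₁ (r₁ _ _)) (h₂ r₂)) af₂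
af-∪-pred af₁ (full r₂) h₁ h₂ = af-mono (λ r₁ → factor (h₁ r₁) (h₂ (r₂ _ _))) af₁
af-∪-pred {S = S} (lift g₁) (lift g₂) h₁ h₂ = lift λ a →
  af-mono [ [ Sum.map inj₁ inj₁ , inj₁ ∘ inj₂ ] , inj₂ ∘ inj₂ ]
    (af-∪-const (af-∪-pred (g₁ a) (lift g₂) (shift a h₁) (weaken a h₂))
                (af-∪-pred (lift g₁) (g₂ a) (weaken a h₁) (shift a h₂))
                exchange exchange)
  where
  exchange : {X Y Z W : Set} → ((X ⊎ Y) ⊎ Z) ⊎ W → ((X ⊎ Y) ⊎ W) ⊎ Z
  exchange = [ [ inj₁ ∘ inj₁ , inj₂ ] , inj₁ ∘ inj₂ ]
  weaken : ∀ {Q} {V : Pred _ 0ℓ} {W : Set} a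
         → Q ⇒ (λ x y → S x y ⊎ V x) → Q ⇒ (λ x y → ((S x y ⊎ S a x) ⊎ W) ⊎ V x)
  weaken a h r = map₁ (inj₁ ∘ inj₁) (h r)
  shift : ∀ {Q} {V : Pred _ 0ℓ} a
        → Q ⇒ (λ x y → S x y ⊎ V x) → Q ↑ a ⇒ (λ x y → ((S x y ⊎ S a x) ⊎ V a) ⊎ V x)
  shift a h = [ (λ r → map₁ (inj₁ ∘ inj₁) (h r)) , (λ r → inj₁ (map₁ inj₂ (h r))) ]

af-∩ : AlmostFull Q₁ → AlmostFull Q₂ → AlmostFull (Q₁ ∩ Q₂)
af-∩ (full r₁) af₂ = af-mono (λ r₂ → r₁ _ _ , r₂) af₂
af-∩ af₁ (full r₂) = af-mono (λ r₁ → r₁ , r₂ _ _) af₁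
af-∩ (lift g₁) (lift g₂) = lift λ a →
  af-∪-pred (af-∩ (g₁ a) (lift g₂)) (af-∩ (lift g₁) (g₂ a))
    (λ { (inj₁ r₁ , r₂) → inj₁ (r₁ , r₂) ; (inj₂ r₁ , _) → inj₂ r₁ })
    (λ { (r₁ , inj₁ r₂) → inj₁ (r₁ , r₂) ; (_ , inj₂ r₂) → inj₂ r₂ })

af-× : AlmostFull Q → AlmostFull S → AlmostFull (×-Pointwise Q S)
af-× af₁ af₂ = af-∩ (af-on proj₁ af₁) (af-on proj₂ af₂)

af-Pointwise : AlmostFull Q → ∀ n → AlmostFull (Pointwise Q {n})
af-Pointwise af zero    = full λ _ _ ()
af-Pointwise af (suc n) =
  af-mono (λ { (r , rs) zero → r ; (r , rs) (suc i) → rs i })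
    (af-on (λ xs → head xs , tail xs) (af-× af (af-Pointwise af n)))

Implies : Rel Bool 0ℓ
Implies b b′ = T b → T b′

af-Implies : AlmostFull Implies
af-Implies = lift λ
  { false → full λ _ _ → inj₂ λ ()
  ; true  → lift λ { false → full λ _ _ → inj₂ (inj₁ λ ())
                   ; true  → full λ _ _ → inj₂ (inj₂ id) } }

data WithBottom {A : Set} (Q : Rel A 0ℓ) : Rel (Maybe A) 0ℓ where
  nothing : ∀ {y} → WithBottom Q nothing y
  just    : ∀ {x y} → Q x y → WithBottom Q (just x) (just y)

withBottom? : Decidable Q → Decidable (WithBottom Q)
withBottom? Q? nothing  y        = yes nothing
withBottom? Q? (just x) nothing  = no λ ()
withBottom? Q? (just x) (just y) with Q? x y
... | yes r = yes (just r)
... | no ¬r = no λ { (just r) → ¬r r }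

af-WithBottom : AlmostFull Q → AlmostFull (WithBottom Q)
af-WithBottom (full r) = lift λ
  { nothing  → full λ _ _ → inj₂ nothing
  ; (just a) → full λ { nothing _ → inj₁ nothing ; (just x) _ → inj₂ (just (r a x)) } }
af-WithBottom (lift g) = lift λ
  { nothing  → full λ _ _ → inj₂ nothing
  ; (just a) → af-mono (λ { nothing          → inj₁ nothing
                           ; (just (inj₁ r)) → inj₁ (just r)
                           ; (just (inj₂ r)) → inj₂ (just r) })
                       (af-WithBottom (g a)) }

↑-dec : Decidable Q → ∀ a → Decidable (Q ↑ a)
↑-dec Q? a x y = Q? x y ⊎-dec Q? a x

Sublist-↑-avoiding : All (∁ (Q a)) xs → Sublist (Q ↑ a) xs ys → Sublist Q xs ys
Sublist-↑-avoiding nd       []           = []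
Sublist-↑-avoiding nd       (y ∷ʳ s)     = y ∷ʳ Sublist-↑-avoiding nd s
Sublist-↑-avoiding (_ ∷ nd) (inj₁ r ∷ s) = r ∷ Sublist-↑-avoiding nd s
Sublist-↑-avoiding (¬r ∷ _) (inj₂ r ∷ s) = contradiction r ¬r

mutual
  af-Sublist : Decidable Q → AlmostFull Q → AlmostFull (Sublist Q)
  af-Sublist Q? af = lift (af-Sublist-↑ Q? af)

  af-avoiding : Decidable Q → AlmostFull Q → ∀ a
              → AlmostFull (λ xs ys → All (∁ (Q a)) xs → Sublist Q xs ys)
  af-avoiding Q? (full r) a = full λ
    { [] ys _               → minimum ys
    ; (x ∷ _) _ (¬r ∷ _) → contradiction (r a x) ¬r }
  af-avoiding Q? (lift g) a = af-mono (λ s nd → Sublist-↑-avoiding nd s) (af-Sublist (↑-dec Q? a) (g a))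

  af-Sublist-↑ : {Q : Rel A 0ℓ} → Decidable Q → AlmostFull Q → ∀ w → AlmostFull (Sublist Q ↑ w)
  af-Sublist-↑ Q? af []      = full λ xs _ → inj₂ (minimum xs)
  -- Each list is cut at its first element above a.  The prefixes avoid a and are compared by
  -- af-avoiding, which recurses on the proof for Q; the rests by the induction on w.
  af-Sublist-↑ {A = A} {Q = Q} Q? af (a ∷ v) =
    af-mono (λ {xs} {ys} → combine (split xs) (split ys))
      (af-on (cut ∘ split)
        (af-× (af-avoiding Q? af a) (af-WithBottom (af-× af (af-Sublist-↑ Q? af v)))))
    where
    Split : List A → Set
    Split xs = FirstView (∁ (Q a)) (Q a) xs ⊎ All (∁ (Q a)) xs

    split : ∀ xs → Split xs
    split xs = map₁ toView (first (λ x → Sum.swap (toSum (Q? a x))) xs)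

    cut : ∀ {xs} → Split xs → List A × Maybe (A × List A)
    cut (inj₁ (_++_∷_ {xs = u} {y = x} _ _ t)) = u , just (x , t)
    cut {xs} (inj₂ _) = xs , nothing

    combine : ∀ {xs ys} (sx : Split xs) (sy : Split ys)
            → ×-Pointwise (λ u u′ → All (∁ (Q a)) u → Sublist Q u u′)
                          (WithBottom (×-Pointwise Q (Sublist Q ↑ v))) (cut sx) (cut sy)
            → (Sublist Q ↑ (a ∷ v)) xs ys
    combine (inj₂ nd) (inj₂ _) (u⊆ , _) = inj₁ (u⊆ nd)
    combine (inj₂ nd) (inj₁ (_++_∷_ {y = x′} _ _ t′)) (u⊆ , _) = inj₁ (++ʳ (x′ ∷ t′) (u⊆ nd))
    combine (inj₁ (_ ++ _ ∷ _)) (inj₂ _) (_ , ())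
    combine (inj₁ (nd ++ _ ∷ _)) (inj₁ (_ ++ _ ∷ _)) (u⊆ , just (x≤ , inj₁ t⊆)) =
      inj₁ (++⁺ (u⊆ nd) (x≤ ∷ t⊆))
    combine (inj₁ (_++_∷_ {xs = u} _ r _)) (inj₁ (_ ++ _ ∷ _)) (_ , just (_ , inj₂ v⊆)) =
      inj₂ (++ˡ u (r ∷ v⊆))

Label : ℕ → Set
Label k = Fin k → Bool

Tree : ℕ → ℕ → Set
Tree k zero    = Label k
Tree k (suc h) = Label k × List (Maybe (Tree k h))

Embed : ∀ h → Rel (Tree k h) 0ℓ
Embed zero    = Pointwise Implies
Embed (suc h) = ×-Pointwise (Pointwise Implies) (Sublist (WithBottom (Embed h)))

embed? : ∀ h → Decidable (Embed {k} h)
embed? zero    = decidable λ b b′ → T? b →-dec T? b′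
embed? (suc h) = ×-decidable (embed? zero) (sublist? (withBottom? (embed? h)))

af-Embed : ∀ h → AlmostFull (Embed {k} h)
af-Embed zero    = af-Pointwise af-Implies _
af-Embed (suc h) =
  af-× (af-Embed zero) (af-Sublist (withBottom? (embed? h)) (af-WithBottom (af-Embed h)))

Sublist-tabulate⁻ : {P : REL X Y 0ℓ} {f : Fin m → X} {g : Fin n → Y}
                  → Sublist P (tabulate f) (tabulate g)
                  → Σ[ e ∈ (Fin m → Fin n) ] Injective _≡_ _≡_ e × (∀ i → P (f i) (g (e i)))
Sublist-tabulate⁻ {m = zero} _ = (λ ()) , (λ { {()} }) , (λ ())
Sublist-tabulate⁻ {m = suc m} {n = zero} ()
Sublist-tabulate⁻ {m = suc m} {n = suc n} (p ∷ s) =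
  let e , e-inj , e-ok = Sublist-tabulate⁻ s
  in Fin.lift 1 e , lift-injective e e-inj 1 , λ { zero → p ; (suc i) → e-ok i }
Sublist-tabulate⁻ {m = suc m} {n = suc n} (_ ∷ʳ s) =
  let e , e-inj , e-ok = Sublist-tabulate⁻ s
  in suc ∘ e , e-inj ∘ suc-injective , e-ok

WithBottom-if : ∀ {Q : Rel X 0ℓ} b {b′ x y} → T b
              → WithBottom Q (if b then just x else nothing) (if b′ then just y else nothing)
              → T b′ × Q x y
WithBottom-if true {true} _ (just q) = tt , q

module _ {M : Model k n} where

  _▷_ : ∀ {u x z} → Path M u x → T (R M x z) → Path M u z
  here       ▷ r = step r here
  step r₀ p ▷ r = step r₀ (p ▷ r)

  here≢step : ∀ {u d y} {r : T (R M u d)} {q : Path M d y}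
            → _≢_ {A = ∃ (Path M u)} (u , here) (y , step r q)
  here≢step ()

  step-injectiveˡ : ∀ {u d₁ d₂ y₁ y₂} {r₁ : T (R M u d₁)} {r₂ : T (R M u d₂)}
                    {q₁ : Path M d₁ y₁} {q₂ : Path M d₂ y₂}
                  → _≡_ {A = ∃ (Path M u)} (y₁ , step r₁ q₁) (y₂ , step r₂ q₂) → d₁ ≡ d₂
  step-injectiveˡ refl = refl

  step-injectiveʳ : ∀ {u d y₁ y₂} {r : T (R M u d)} {q₁ : Path M d y₁} {q₂ : Path M d y₂}
                  → _≡_ {A = ∃ (Path M u)} (y₁ , step r q₁) (y₂ , step r q₂) → (y₁ , q₁) ≡ (y₂ , q₂)
  step-injectiveʳ refl = refl

module _ (M : Model k n) where

  label : Fin n → Label k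
  label u p = V M p u

  unfold : ∀ h → Fin n → Tree k h
  unfold zero    u = label u
  unfold (suc h) u = label u , tabulate λ c → if R M u c then just (unfold h c) else nothing

module Simulation (A : Model k m) (B : Model k n) where

  _⊑[_]_ : Fin m → ℕ → Fin n → Set
  u ⊑[ h ] v = Embed h (unfold A h u) (unfold B h v)

  ⊑⇒label : ∀ h {u v} → u ⊑[ h ] v → Pointwise Implies (label A u) (label B v)
  ⊑⇒label zero    = id
  ⊑⇒label (suc h) = proj₁

  record ChildEmbedding (h : ℕ) (u : Fin m) (v : Fin n) : Set where
    field
      child     : Fin m → Fin n
      injective : Injective _≡_ _≡_ child
      edge      : ∀ {c} → T (R A u c) → T (R B v (child c))
      below     : ∀ {c} → T (R A u c) → c ⊑[ h ] child c

  children : ∀ {h u v} → u ⊑[ suc h ] v → ChildEmbedding h u v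
  children {u = u} (_ , s) with Sublist-tabulate⁻ s
  ... | e , e-inj , e-ok = record
    { child     = e
    ; injective = e-inj
    ; edge      = λ {c} r → proj₁ (WithBottom-if (R A u c) r (e-ok c))
    ; below     = λ {c} r → proj₂ (WithBottom-if (R A u c) r (e-ok c))
    }

  trace : ∀ h {u v x} → u ⊑[ h ] v → (p : Path A u x) → pathLength p ≤ h → ∃ (Path B v)
  trace _       _  here       _       = -, here
  trace (suc h) uv (step r p) (s≤s l) = map₂ (step (edge r)) (trace h (below r) p l)
    where open ChildEmbedding (children uv)

  trace-label : ∀ h {u v x} (uv : u ⊑[ h ] v) (p : Path A u x) (l : pathLength p ≤ h)
              → Pointwise Implies (label A x) (label B (proj₁ (trace h uv p l)))
  trace-label h       uv here       _       = ⊑⇒label h uv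
  trace-label (suc h) uv (step r p) (s≤s l) = trace-label h (below r) p l
    where open ChildEmbedding (children uv)

  trace-edge : ∀ h {u v x z} (uv : u ⊑[ h ] v) (p : Path A u x) (r : T (R A x z))
               (l : pathLength p ≤ h) (l′ : pathLength (p ▷ r) ≤ h)
             → T (R B (proj₁ (trace h uv p l)) (proj₁ (trace h uv (p ▷ r) l′)))
  trace-edge (suc h) uv here        r _       (s≤s z≤n) = edge r
    where open ChildEmbedding (children uv)
  trace-edge (suc h) uv (step r₀ p) r (s≤s l) (s≤s l′)  = trace-edge h (below r₀) p r l l′
    where open ChildEmbedding (children uv)

  trace-injective : ∀ h {u v x x′} (uv : u ⊑[ h ] v) (p : Path A u x) (p′ : Path A u x′)
                    (l : pathLength p ≤ h) (l′ : pathLength p′ ≤ h)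
                  → trace h uv p l ≡ trace h uv p′ l′ → x ≡ x′
  trace-injective _       uv here        here        _       _        _  = refl
  trace-injective (suc h) uv here        (step _ _)  _       (s≤s _)  eq = contradiction eq here≢step
  trace-injective (suc h) uv (step _ _)  here        (s≤s _) _        eq = contradiction (sym eq) here≢step
  trace-injective (suc h) uv (step r₁ p₁) (step r₂ p₂) (s≤s l₁) (s≤s l₂) eq
    with ChildEmbedding.injective (children uv) (step-injectiveˡ eq)
  ... | refl with T-irrelevant r₁ r₂
  ... | refl = trace-injective h (ChildEmbedding.below (children uv) r₁) p₁ p₂ l₁ l₂ (step-injectiveʳ eq)

encode : ∀ L → PModel k → Tree k L
encode L 𝔐 = unfold (model 𝔐) L (root 𝔐)

Embed⇒≼inj : ∀ {L} {𝔄 𝔅 : PModel k} → TreeShaped 𝔄 → HeightAtMost L 𝔄 → TreeShaped 𝔅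
           → Embed L (encode L 𝔄) (encode L 𝔅) → 𝔄 ≼inj 𝔅
Embed⇒≼inj {L = L} {pointed m A w} {pointed n B w′} tree-A height-A tree-B ww′ =
  record { fun = f ; pres-pt = f-root ; pres-R = f-edge ; pres-V = f-label } , f-injective
  where
  open Simulation A B

  path : ∀ x → Path A w x
  path x = proj₁ (tree-A x)

  image : ∀ {x} → Path A w x → ∃ (Path B w′)
  image p = trace L ww′ p (height-A p)

  f : Fin m → Fin n
  f x = proj₁ (image (path x))

  f-root : f w ≡ w′
  f-root = cong (proj₁ ∘ image) (proj₂ (tree-A w) (path w) here)

  f-label : ∀ p x → T (V A p x) → T (V B p (f x))
  f-label p x = trace-label L ww′ (path x) _ p

  f-edge : ∀ x z → T (R A x z) → T (R B (f x) (f z))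
  f-edge x z r = subst (λ p → T (R B (f x) (proj₁ (image p))))
                       (proj₂ (tree-A z) (path x ▷ r) (path z))
                       (trace-edge L ww′ (path x) r _ _)

  image-unique : ∀ (s t : ∃ (Path B w′)) → proj₁ s ≡ proj₁ t → s ≡ t
  image-unique (y , q) (.y , q′) refl = cong (y ,_) (proj₂ (tree-B y) q q′)

  f-injective : Injective _≡_ _≡_ f
  f-injective {x} {x′} fx≡fx′ = trace-injective L ww′ (path x) (path x′) _ _
                                   (image-unique (image (path x)) (image (path x′)) fx≡fx′)

≼hom-refl : (𝔐 : PModel k) → 𝔐 ≼hom 𝔐
≼hom-refl 𝔐 = record { fun = id ; pres-pt = refl ; pres-R = λ _ _ → id ; pres-V = λ _ _ → id }

≼hom-trans : {𝔄 𝔅 ℭ : PModel k} → 𝔄 ≼hom 𝔅 → 𝔅 ≼hom ℭ → 𝔄 ≼hom ℭ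
≼hom-trans f g = record
  { fun     = fun g ∘ fun f
  ; pres-pt = trans (cong (fun g) (pres-pt f)) (pres-pt g)
  ; pres-R  = λ u z → pres-R g _ _ ∘ pres-R f u z
  ; pres-V  = λ p u → pres-V g p _ ∘ pres-V f p u
  }

≼inj-refl : (𝔐 : PModel k) → 𝔐 ≼inj 𝔐
≼inj-refl 𝔐 = ≼hom-refl 𝔐 , id

≼inj-trans : {𝔄 𝔅 ℭ : PModel k} → 𝔄 ≼inj 𝔅 → 𝔅 ≼inj ℭ → 𝔄 ≼inj ℭ
≼inj-trans (f , f-inj) (g , g-inj) = ≼hom-trans f g , f-inj ∘ g-inj

corollary3p3 : ∀ {ℓ : Level} (k L : ℕ) (𝒯 : PModel k → Set ℓ)
    → (∀ M → 𝒯 M → TreeShaped M × HeightAtMost L M)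
    → IsWQOOn 𝒯 _≼inj_ × IsWQOOn 𝒯 _≼hom_
corollary3p3 k L 𝒯 tree-of-height =
    ((λ 𝔐 _ → ≼inj-refl 𝔐) , (λ _ _ _ _ _ _ → ≼inj-trans) , good-inj)
  , ((λ 𝔐 _ → ≼hom-refl 𝔐) , (λ _ _ _ _ _ _ → ≼hom-trans) , good-hom)
  where
  good-inj : (s : ℕ → PModel k) → (∀ i → 𝒯 (s i)) → Σ[ i ∈ ℕ ] Σ[ j ∈ ℕ ] (i < j × s i ≼inj s j)
  good-inj s s∈𝒯 =
    let i , j , i<j , embeds  = af-good (af-Embed L) (encode L ∘ s)
        tree-i , height-i     = tree-of-height (s i) (s∈𝒯 i)
        tree-j , _            = tree-of-height (s j) (s∈𝒯 j)
    in  i , j , i<j , Embed⇒≼inj tree-i height-i tree-j embeds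

  good-hom : (s : ℕ → PModel k) → (∀ i → 𝒯 (s i)) → Σ[ i ∈ ℕ ] Σ[ j ∈ ℕ ] (i < j × s i ≼hom s j)
  good-hom s s∈𝒯 = map₂ (map₂ (map₂ proj₁)) (good-inj s s∈𝒯)
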